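{- Let $(\mathcal{C},\oplus,0,\otimes,1)$ be a finite coproduct rig category and $(T,\eta,\mu,m)$ a symmetric monoidal monad on $(\mathcal{C},\otimes,1)$. Then for all objects $X,Y,Z$: $$\delta^r_{TX,TY,TZ};(s_{X,Z}\oplus s_{Y,Z});k_{X\otimes Z,Y\otimes Z}=(k_{X,Y}\otimes\mathrm{id}_{TZ});s_{X\oplus Y,Z};T(\delta^r_{X,Y,Z})$$ as arrows $(TX\oplus TY)\otimes TZ\to T((X\otimes Z)\oplus(Y\otimes Z))$.
   Context: Composition is diagrammatic. A finite coproduct rig category has symmetric monoidal structures $(\otimes,1)$ and $(\oplus,0)$, natural isomorphisms $\delta^l,\delta^r$ ($\delta^r_{X,Y,Z}\colon(X\oplus Y)\otimes Z\to(X\otimes Z)\oplus(Y\otimes Z)$), $\lambda^\bullet,\rho^\bullet$ satisfying Laplaza's coherence axioms, and $\oplus$ is a coproduct with codiagonals $\nabla_X\colon X\oplus X\to X$ and initial object $0$ with $¡_X\colon0\to X$ (natural, coherent commutative monoids). Coproduct injections: $\iota^l_X:=(\rho^\oplus_X)^{ -1};(\mathrm{id}_X\oplus¡_Y)\colon X\to X\oplus Y$ and $\iota^r_Y:=(\lambda^\oplus_Y)^{ -1};(¡_X\oplus\mathrm{id}_Y)$, where $\lambda^\oplus,\rho^\oplus$ are the unitors of $\oplus$. $k_{X,Y}\colon TX\oplus TY\to T(X\oplus Y)$ is $(T(\iota^l_X)\oplus T(\iota^r_Y));\nabla_{T(X\oplus Y)}$. A symmetric monoidal monad is a monad with natural $m_{X,Y}\colon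 TX\otimes TY\to T(X\otimes Y)$ making $T$ lax symmetric monoidal and $\eta,\mu$ monoidal. Its left and right strengths are $l_{X,Y}:=(\eta_X\otimes\mathrm{id}_{TY});m_{X,Y}\colon X\otimes TY\to T(X\otimes Y)$ and $r_{X,Y}:=(\mathrm{id}_{TX}\otimes\eta_Y);m_{X,Y}\colon TX\otimes Y\to T(X\otimes Y)$, and $s_{X,Y}:=r_{X,TY};T(l_{X,Y});\mu_{X\otimes Y}\colon TX\otimes TY\to T(X\otimes Y)$ (which coincides with $l_{TX,Y};T(r_{X,Y});\mu_{X\otimes Y}$). -}

module Defs where

open import Level using (Level; _⊔_) renaming (suc to lsuc)
open import Relation.Binary using (Rel; IsEquivalence)

-- Categories (hom-setoids), composition written DIAGRAMMATICALLY:
--   f ⨾ g : A ⇒ C   for   f : A ⇒ B,  g : B ⇒ C   ("first f, then g").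

record Category (o ℓ e : Level) : Set (lsuc (o ⊔ ℓ ⊔ e)) where
  infix  4 _≈_ _⇒_
  infixl 9 _⨾_
  field
    Obj      : Set o
    _⇒_      : Obj → Obj → Set ℓ
    _≈_      : ∀ {A B} → Rel (A ⇒ B) e
    id       : ∀ {A} → A ⇒ A
    _⨾_      : ∀ {A B C} → A ⇒ B → B ⇒ C → A ⇒ C
    ≈-equiv  : ∀ {A B} → IsEquivalence (_≈_ {A} {B})
    ⨾-resp-≈ : ∀ {A B C} {f f′ : A ⇒ B} {g g′ : B ⇒ C} →
               f ≈ f′ → g ≈ g′ → f ⨾ g ≈ f′ ⨾ g′
    assoc    : ∀ {A B C D} {f : A ⇒ B} {g : B ⇒ C} {h : C ⇒ D} →
               (f ⨾ g) ⨾ h ≈ f ⨾ (g ⨾ h)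
    identityˡ : ∀ {A B} {f : A ⇒ B} → id ⨾ f ≈ f
    identityʳ : ∀ {A B} {f : A ⇒ B} → f ⨾ id ≈ f

module _ {o ℓ e : Level} (𝒞 : Category o ℓ e) where
  open Category 𝒞

  record Endofunctor : Set (o ⊔ ℓ ⊔ e) where
    field
      F₀ : Obj → Obj
      F₁ : ∀ {A B} → A ⇒ B → F₀ A ⇒ F₀ B
      F-identity : ∀ {A} → F₁ (id {A}) ≈ id
      F-homo     : ∀ {A B C} {f : A ⇒ B} {g : B ⇒ C} →
                   F₁ (f ⨾ g) ≈ F₁ f ⨾ F₁ g
      F-resp-≈   : ∀ {A B} {f g : A ⇒ B} → f ≈ g → F₁ f ≈ F₁ g

  record SymmetricMonoidal : Set (o ⊔ ℓ ⊔ e) where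
    infixr 10 _·₀_ _·₁_
    field
      _·₀_ : Obj → Obj → Obj
      _·₁_ : ∀ {A B C D} → A ⇒ B → C ⇒ D → (A ·₀ C) ⇒ (B ·₀ D)
      ·-identity : ∀ {A B} → (id {A} ·₁ id {B}) ≈ id
      ·-homo     : ∀ {A B C D E F} {f : A ⇒ B} {g : B ⇒ C} {h : D ⇒ E} {k : E ⇒ F} →
                   ((f ⨾ g) ·₁ (h ⨾ k)) ≈ (f ·₁ h) ⨾ (g ·₁ k)
      ·-resp-≈   : ∀ {A B C D} {f f′ : A ⇒ B} {g g′ : C ⇒ D} →
                   f ≈ f′ → g ≈ g′ → (f ·₁ g) ≈ (f′ ·₁ g′)
      I   : Obj
      α   : ∀ {A B C} → (A ·₀ B) ·₀ C ⇒ A ·₀ (B ·₀ C)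
      α⁻¹ : ∀ {A B C} → A ·₀ (B ·₀ C) ⇒ (A ·₀ B) ·₀ C
      λu   : ∀ {A} → I ·₀ A ⇒ A
      λu⁻¹ : ∀ {A} → A ⇒ I ·₀ A
      ρu   : ∀ {A} → A ·₀ I ⇒ A
      ρu⁻¹ : ∀ {A} → A ⇒ A ·₀ I
      σ    : ∀ {A B} → A ·₀ B ⇒ B ·₀ A
      α-isoˡ : ∀ {A B C} → α {A} {B} {C} ⨾ α⁻¹ ≈ id
      α-isoʳ : ∀ {A B C} → α⁻¹ {A} {B} {C} ⨾ α ≈ id
      λ-isoˡ : ∀ {A} → λu {A} ⨾ λu⁻¹ ≈ id
      λ-isoʳ : ∀ {A} → λu⁻¹ {A} ⨾ λu ≈ id
      ρ-isoˡ : ∀ {A} → ρu {A} ⨾ ρu⁻¹ ≈ id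
      ρ-isoʳ : ∀ {A} → ρu⁻¹ {A} ⨾ ρu ≈ id
      σ-involutive : ∀ {A B} → σ {A} {B} ⨾ σ ≈ id
      α-natural : ∀ {A A′ B B′ C C′} {f : A ⇒ A′} {g : B ⇒ B′} {h : C ⇒ C′} →
                  ((f ·₁ g) ·₁ h) ⨾ α ≈ α ⨾ (f ·₁ (g ·₁ h))
      λ-natural : ∀ {A B} {f : A ⇒ B} → (id ·₁ f) ⨾ λu ≈ λu ⨾ f
      ρ-natural : ∀ {A B} {f : A ⇒ B} → (f ·₁ id) ⨾ ρu ≈ ρu ⨾ f
      σ-natural : ∀ {A A′ B B′} {f : A ⇒ A′} {g : B ⇒ B′} →
                  (f ·₁ g) ⨾ σ ≈ σ ⨾ (g ·₁ f)
      triangle : ∀ {A B} → α {A} {I} {B} ⨾ (id ·₁ λu) ≈ (ρu ·₁ id)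
      pentagon : ∀ {A B C D} →
                 (α {A} {B} {C} ·₁ id {D}) ⨾ α ⨾ (id ·₁ α) ≈ α ⨾ α
      hexagon  : ∀ {A B C} →
                 α {A} {B} {C} ⨾ σ ⨾ α ≈ (σ ·₁ id) ⨾ α ⨾ (id ·₁ σ)

module _ {o ℓ e : Level} {𝒞 : Category o ℓ e}
         (Mt : SymmetricMonoidal 𝒞) (Mp : SymmetricMonoidal 𝒞) where
  open Category 𝒞
  open SymmetricMonoidal Mt renaming
    ( _·₀_ to _⊗₀_ ; _·₁_ to _⊗₁_ ; I to 𝟙 ; α to α⊗ ; α⁻¹ to α⊗⁻¹
    ; λu to λ⊗ ; ρu to ρ⊗ ; σ to σ⊗ ) using ()
  open SymmetricMonoidal Mp renaming
    ( _·₀_ to _⊕₀_ ; _·₁_ to _⊕₁_ ; I to 𝟘 ; α to α⊕ ; α⁻¹ to α⊕⁻¹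
    ; λu to λ⊕ ; ρu to ρ⊕ ; σ to σ⊕ ) using ()

  interchange⊕ : ∀ {P Q R S} → (P ⊕₀ Q) ⊕₀ (R ⊕₀ S) ⇒ (P ⊕₀ R) ⊕₀ (Q ⊕₀ S)
  interchange⊕ = α⊕ ⨾ (id ⊕₁ α⊕⁻¹) ⨾ (id ⊕₁ (σ⊕ ⊕₁ id)) ⨾ (id ⊕₁ α⊕) ⨾ α⊕⁻¹

  record RigAxioms : Set (o ⊔ ℓ ⊔ e) where
    field
      δˡ   : ∀ {A B C} → A ⊗₀ (B ⊕₀ C) ⇒ (A ⊗₀ B) ⊕₀ (A ⊗₀ C)
      δˡ⁻¹ : ∀ {A B C} → (A ⊗₀ B) ⊕₀ (A ⊗₀ C) ⇒ A ⊗₀ (B ⊕₀ C)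
      δʳ   : ∀ {A B C} → (A ⊕₀ B) ⊗₀ C ⇒ (A ⊗₀ C) ⊕₀ (B ⊗₀ C)
      δʳ⁻¹ : ∀ {A B C} → (A ⊗₀ C) ⊕₀ (B ⊗₀ C) ⇒ (A ⊕₀ B) ⊗₀ C
      λ•   : ∀ {A} → 𝟘 ⊗₀ A ⇒ 𝟘
      λ•⁻¹ : ∀ {A} → 𝟘 ⇒ 𝟘 ⊗₀ A
      ρ•   : ∀ {A} → A ⊗₀ 𝟘 ⇒ 𝟘
      ρ•⁻¹ : ∀ {A} → 𝟘 ⇒ A ⊗₀ 𝟘
      δˡ-isoˡ : ∀ {A B C} → δˡ {A} {B} {C} ⨾ δˡ⁻¹ ≈ id
      δˡ-isoʳ : ∀ {A B C} → δˡ⁻¹ {A} {B} {C} ⨾ δˡ ≈ id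
      δʳ-isoˡ : ∀ {A B C} → δʳ {A} {B} {C} ⨾ δʳ⁻¹ ≈ id
      δʳ-isoʳ : ∀ {A B C} → δʳ⁻¹ {A} {B} {C} ⨾ δʳ ≈ id
      λ•-isoˡ : ∀ {A} → λ• {A} ⨾ λ•⁻¹ ≈ id
      λ•-isoʳ : ∀ {A} → λ•⁻¹ {A} ⨾ λ• ≈ id
      ρ•-isoˡ : ∀ {A} → ρ• {A} ⨾ ρ•⁻¹ ≈ id
      ρ•-isoʳ : ∀ {A} → ρ•⁻¹ {A} ⨾ ρ• ≈ id
      δˡ-natural : ∀ {A A′ B B′ C C′} {f : A ⇒ A′} {g : B ⇒ B′} {h : C ⇒ C′} →
                   (f ⊗₁ (g ⊕₁ h)) ⨾ δˡ ≈ δˡ ⨾ ((f ⊗₁ g) ⊕₁ (f ⊗₁ h))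
      δʳ-natural : ∀ {A A′ B B′ C C′} {f : A ⇒ A′} {g : B ⇒ B′} {h : C ⇒ C′} →
                   ((f ⊕₁ g) ⊗₁ h) ⨾ δʳ ≈ δʳ ⨾ ((f ⊗₁ h) ⊕₁ (g ⊗₁ h))
      λ•-natural : ∀ {A B} {f : A ⇒ B} → (id ⊗₁ f) ⨾ λ• ≈ λ•
      ρ•-natural : ∀ {A B} {f : A ⇒ B} → (f ⊗₁ id) ⨾ ρ• ≈ ρ•
      laplazaI    : ∀ {A B C} → δˡ {A} {B} {C} ⨾ σ⊕ ≈ (id ⊗₁ σ⊕) ⨾ δˡ
      laplazaII   : ∀ {A B C} → δʳ {A} {B} {C} ≈ σ⊗ ⨾ δˡ ⨾ (σ⊗ ⊕₁ σ⊗)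
      laplazaIII  : ∀ {A B C D} →
                    δʳ {A} {B ⊕₀ C} {D} ⨾ (id ⊕₁ δʳ) ⨾ α⊕⁻¹
                      ≈ (α⊕⁻¹ ⊗₁ id) ⨾ δʳ ⨾ (δʳ ⊕₁ id)
      laplazaIV   : ∀ {A B C D} →
                    δˡ {A} {B} {C ⊕₀ D} ⨾ (id ⊕₁ δˡ) ⨾ α⊕⁻¹
                      ≈ (id ⊗₁ α⊕⁻¹) ⨾ δˡ ⨾ (δˡ ⊕₁ id)
      laplazaV    : ∀ {A B C D} →
                    (id {A} ⊗₁ δˡ {B} {C} {D}) ⨾ δˡ ⨾ (α⊗⁻¹ ⊕₁ α⊗⁻¹) ≈ α⊗⁻¹ ⨾ δˡ
      laplazaVI   : ∀ {A B C D} →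
                    δʳ {A} {B} {C ⊗₀ D} ⨾ (α⊗⁻¹ ⊕₁ α⊗⁻¹) ≈ α⊗⁻¹ ⨾ (δʳ ⊗₁ id) ⨾ δʳ
      laplazaVII  : ∀ {A B C D} →
                    α⊗⁻¹ {A} {B ⊕₀ C} {D} ⨾ (δˡ ⊗₁ id) ⨾ δʳ
                      ≈ (id ⊗₁ δʳ) ⨾ δˡ ⨾ (α⊗⁻¹ ⊕₁ α⊗⁻¹)
      laplazaVIII : ∀ {A B C D} →
                    δˡ {A ⊕₀ B} {C} {D} ⨾ (δʳ ⊕₁ δʳ) ⨾ interchange⊕
                      ≈ δʳ ⨾ (δˡ ⊕₁ δˡ)
      laplazaIX   : λ• {𝟘} ≈ ρ• {𝟘}
      laplazaX    : λ• {𝟙} ≈ ρ⊗ {𝟘}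
      laplazaXI   : ρ• {𝟙} ≈ λ⊗ {𝟘}
      laplazaXII  : ∀ {A B} → λ• {A ⊗₀ B} ≈ α⊗⁻¹ ⨾ (λ• ⊗₁ id) ⨾ λ•
      laplazaXIII : ∀ {A B} → ρ• {A ⊗₀ B} ≈ α⊗ ⨾ (id ⊗₁ ρ•) ⨾ ρ•
      laplazaXIV  : ∀ {A B} → (ρ• {A} ⊗₁ id {B}) ⨾ λ• ≈ α⊗ ⨾ (id ⊗₁ λ•) ⨾ ρ•
      laplazaXV   : ∀ {A B} → ρ• {A ⊕₀ B} ≈ δʳ ⨾ (ρ• ⊕₁ ρ•) ⨾ λ⊕
      laplazaXVI  : ∀ {A B} → λ• {A ⊕₀ B} ≈ δˡ ⨾ (λ• ⊕₁ λ•) ⨾ λ⊕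
      laplazaXVII : ∀ {A B} → δˡ {A} {𝟘} {B} ⨾ (ρ• ⊕₁ id) ⨾ λ⊕ ≈ (id ⊗₁ λ⊕)
      laplazaXVIII : ∀ {A B} → δʳ {𝟘} {A} {B} ⨾ (λ• ⊕₁ id) ⨾ λ⊕ ≈ (λ⊕ ⊗₁ id)
      laplazaXIX  : ∀ {A B} → δˡ {A} {B} {𝟘} ⨾ (id ⊕₁ ρ•) ⨾ ρ⊕ ≈ (id ⊗₁ ρ⊕)
      laplazaXX   : ∀ {A B} → δʳ {A} {𝟘} {B} ⨾ (id ⊕₁ λ•) ⨾ ρ⊕ ≈ (ρ⊕ ⊗₁ id)
      laplazaXXI  : ∀ {A B} → δˡ {𝟙} {A} {B} ⨾ (λ⊗ ⊕₁ λ⊗) ≈ λ⊗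
      laplazaXXII : ∀ {A B} → δʳ {A} {B} {𝟙} ⨾ (ρ⊗ ⊕₁ ρ⊗) ≈ ρ⊗
      laplazaXXIII : ∀ {A} → λ• {A} ≈ σ⊗ ⨾ ρ•

  -- ⊕ is a coproduct, with initial object 0, initial maps ¡ and codiagonals ∇;
  -- injections ιˡ = (ρ⊕)⁻¹;(id⊕¡), ιʳ = (λ⊕)⁻¹;(¡⊕id).
  record FiniteCoproducts : Set (o ⊔ ℓ ⊔ e) where
    open SymmetricMonoidal Mp using (ρu⁻¹; λu⁻¹)
    field
      ¡        : ∀ {X} → 𝟘 ⇒ X
      ¡-unique : ∀ {X} (f : 𝟘 ⇒ X) → ¡ ≈ f
      [_,_]    : ∀ {X Y Z} → X ⇒ Z → Y ⇒ Z → X ⊕₀ Y ⇒ Z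
      inject₁  : ∀ {X Y Z} {f : X ⇒ Z} {g : Y ⇒ Z} →
                 ρu⁻¹ ⨾ (id ⊕₁ ¡) ⨾ [ f , g ] ≈ f
      inject₂  : ∀ {X Y Z} {f : X ⇒ Z} {g : Y ⇒ Z} →
                 λu⁻¹ ⨾ (¡ ⊕₁ id) ⨾ [ f , g ] ≈ g
      []-unique : ∀ {X Y Z} {f : X ⇒ Z} {g : Y ⇒ Z} (h : X ⊕₀ Y ⇒ Z) →
                  ρu⁻¹ ⨾ (id ⊕₁ ¡) ⨾ h ≈ f → λu⁻¹ ⨾ (¡ ⊕₁ id) ⨾ h ≈ g →
                  h ≈ [ f , g ]
      ∇        : ∀ {X} → X ⊕₀ X ⇒ X
      ∇-inj₁   : ∀ {X} → ρu⁻¹ ⨾ (id ⊕₁ ¡) ⨾ ∇ {X} ≈ id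
      ∇-inj₂   : ∀ {X} → λu⁻¹ ⨾ (¡ ⊕₁ id) ⨾ ∇ {X} ≈ id

module _ {o ℓ e : Level} {𝒞 : Category o ℓ e} (Mt : SymmetricMonoidal 𝒞) where
  open Category 𝒞
  open SymmetricMonoidal Mt renaming
    ( _·₀_ to _⊗₀_ ; _·₁_ to _⊗₁_ ; I to 𝟙 ; α to α⊗
    ; λu to λ⊗ ; ρu to ρ⊗ ; σ to σ⊗ ) using ()

  record SymmetricMonoidalMonad : Set (o ⊔ ℓ ⊔ e) where
    field
      functor : Endofunctor 𝒞
    open Endofunctor functor renaming (F₀ to T₀; F₁ to T₁) public
    field
      η : ∀ {X} → X ⇒ T₀ X
      μ : ∀ {X} → T₀ (T₀ X) ⇒ T₀ X
      η-natural : ∀ {X Y} {f : X ⇒ Y} → f ⨾ η ≈ η ⨾ T₁ f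
      μ-natural : ∀ {X Y} {f : X ⇒ Y} → T₁ (T₁ f) ⨾ μ ≈ μ ⨾ T₁ f
      μ-assoc   : ∀ {X} → T₁ (μ {X}) ⨾ μ ≈ μ ⨾ μ
      μ-identityˡ : ∀ {X} → η {T₀ X} ⨾ μ ≈ id
      μ-identityʳ : ∀ {X} → T₁ (η {X}) ⨾ μ ≈ id
      m  : ∀ {X Y} → T₀ X ⊗₀ T₀ Y ⇒ T₀ (X ⊗₀ Y)
      m₀ : 𝟙 ⇒ T₀ 𝟙
      m-natural : ∀ {X X′ Y Y′} {f : X ⇒ X′} {g : Y ⇒ Y′} →
                  (T₁ f ⊗₁ T₁ g) ⨾ m ≈ m ⨾ T₁ (f ⊗₁ g)
      m-assoc : ∀ {X Y Z} →
                (m {X} {Y} ⊗₁ id {T₀ Z}) ⨾ m ⨾ T₁ α⊗ ≈ α⊗ ⨾ (id ⊗₁ m) ⨾ m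
      m-unitˡ : ∀ {X} → (m₀ ⊗₁ id {T₀ X}) ⨾ m ⨾ T₁ λ⊗ ≈ λ⊗
      m-unitʳ : ∀ {X} → (id {T₀ X} ⊗₁ m₀) ⨾ m ⨾ T₁ ρ⊗ ≈ ρ⊗
      m-symmetric : ∀ {X Y} → σ⊗ ⨾ m {Y} {X} ≈ m ⨾ T₁ σ⊗
      η-monoidal  : ∀ {X Y} → (η {X} ⊗₁ η {Y}) ⨾ m ≈ η
      η-unit      : η {𝟙} ≈ m₀
      μ-monoidal  : ∀ {X Y} → (μ {X} ⊗₁ μ {Y}) ⨾ m ≈ m ⨾ T₁ m ⨾ μ
      μ-unit      : m₀ ⨾ T₁ m₀ ⨾ μ ≈ m₀

record Setting (o ℓ e : Level) : Set (lsuc (o ⊔ ℓ ⊔ e)) where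
  field
    𝒞     : Category o ℓ e
    Mt    : SymmetricMonoidal 𝒞
    Mp    : SymmetricMonoidal 𝒞
    rig   : RigAxioms Mt Mp
    coprod : FiniteCoproducts Mt Mp
    monad : SymmetricMonoidalMonad Mt

module Notation {o ℓ e : Level} (S : Setting o ℓ e) where
  open Setting S
  open Category 𝒞 public
  open SymmetricMonoidal Mt public renaming
    ( _·₀_ to _⊗₀_ ; _·₁_ to _⊗₁_ ; I to 𝟙 ; α to α⊗ ; α⁻¹ to α⊗⁻¹
    ; λu to λ⊗ ; λu⁻¹ to λ⊗⁻¹ ; ρu to ρ⊗ ; ρu⁻¹ to ρ⊗⁻¹ ; σ to σ⊗ ) using ()
  open SymmetricMonoidal Mp public renaming
    ( _·₀_ to _⊕₀_ ; _·₁_ to _⊕₁_ ; I to 𝟘 ; α to α⊕ ; α⁻¹ to α⊕⁻¹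
    ; λu to λ⊕ ; λu⁻¹ to λ⊕⁻¹ ; ρu to ρ⊕ ; ρu⁻¹ to ρ⊕⁻¹ ; σ to σ⊕ ) using ()
  open RigAxioms rig public using (δˡ; δʳ; λ•; ρ•)
  open FiniteCoproducts coprod public using (¡; ∇)
  open SymmetricMonoidalMonad monad public using (T₀; T₁; η; μ; m)

  ιˡ : ∀ {X Y} → X ⇒ X ⊕₀ Y
  ιˡ = ρ⊕⁻¹ ⨾ (id ⊕₁ ¡)

  ιʳ : ∀ {X Y} → Y ⇒ X ⊕₀ Y
  ιʳ = λ⊕⁻¹ ⨾ (¡ ⊕₁ id)

  k : ∀ X Y → T₀ X ⊕₀ T₀ Y ⇒ T₀ (X ⊕₀ Y)
  k X Y = (T₁ (ιˡ {X} {Y}) ⊕₁ T₁ (ιʳ {X} {Y})) ⨾ ∇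

  lstr : ∀ X Y → X ⊗₀ T₀ Y ⇒ T₀ (X ⊗₀ Y)
  lstr X Y = (η ⊗₁ id) ⨾ m {X} {Y}

  rstr : ∀ X Y → T₀ X ⊗₀ Y ⇒ T₀ (X ⊗₀ Y)
  rstr X Y = (id ⊗₁ η) ⨾ m {X} {Y}

  s : ∀ X Y → T₀ X ⊗₀ T₀ Y ⇒ T₀ (X ⊗₀ Y)
  s X Y = rstr X (T₀ Y) ⨾ T₁ (lstr X Y) ⨾ μ

-- Tensoring with TZ preserves the coproduct X ⊕ Y (δʳ is invertible and carries ιˡ ⊗ id, ιʳ ⊗ id
-- to the injections), so it suffices to compare both sides on ιˡ ⊗ id and ιʳ ⊗ id. There each
-- side reduces to s X Z ; T ιˡ (resp. s Y Z ; T ιʳ): on the left because k restricts to T ι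
-- along the injection ι, on the right because moreover s is natural and δʳ preserves injections.
module Submission where

open import Level using (Level)
open import Relation.Binary using (Setoid; IsEquivalence)
import Relation.Binary.Reasoning.Setoid as SetoidReasoning
open import Defs

module CategoryReasoning {o ℓ e : Level} (𝒞 : Category o ℓ e) where
  open Category 𝒞

  module ≈ {A B} = IsEquivalence (≈-equiv {A} {B})

  hom-setoid : Obj → Obj → Setoid ℓ e
  hom-setoid A B = record { Carrier = A ⇒ B ; _≈_ = _≈_ ; isEquivalence = ≈-equiv }

  module HomReasoning {A B} = SetoidReasoning (hom-setoid A B)

  infixl 5 _⟩⨾refl
  infixr 5 refl⟩⨾_

  _⟩⨾refl : ∀ {A B C} {f f′ : A ⇒ B} {g : B ⇒ C} → f ≈ f′ → f ⨾ g ≈ f′ ⨾ g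
  p ⟩⨾refl = ⨾-resp-≈ p ≈.refl

  refl⟩⨾_ : ∀ {A B C} {f : A ⇒ B} {g g′ : B ⇒ C} → g ≈ g′ → f ⨾ g ≈ f ⨾ g′
  refl⟩⨾ p = ⨾-resp-≈ ≈.refl p

  inverse-⨾ : ∀ {A B C} {a : A ⇒ B} {a′ : B ⇒ A} {b : B ⇒ C} {b′ : C ⇒ B} →
              a ⨾ a′ ≈ id → b ⨾ b′ ≈ id → (a ⨾ b) ⨾ (b′ ⨾ a′) ≈ id
  inverse-⨾ {a = a} {a′} {b} {b′} p q = begin
    (a ⨾ b) ⨾ (b′ ⨾ a′) ≈⟨ assoc ⟩
    a ⨾ (b ⨾ (b′ ⨾ a′)) ≈⟨ refl⟩⨾ ≈.sym assoc ⟩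
    a ⨾ ((b ⨾ b′) ⨾ a′) ≈⟨ refl⟩⨾ (q ⟩⨾refl) ⟩
    a ⨾ (id ⨾ a′)       ≈⟨ refl⟩⨾ identityˡ ⟩
    a ⨾ a′              ≈⟨ p ⟩
    id                  ∎
    where open HomReasoning

  transposeʳ : ∀ {A B C} {u : A ⇒ B} {v : B ⇒ C} {v′ : C ⇒ B} {w : A ⇒ C} →
               v ⨾ v′ ≈ id → u ⨾ v ≈ w → u ≈ w ⨾ v′
  transposeʳ {u = u} {v} {v′} {w} p q = begin
    u            ≈⟨ ≈.sym identityʳ ⟩
    u ⨾ id       ≈⟨ refl⟩⨾ ≈.sym p ⟩
    u ⨾ (v ⨾ v′) ≈⟨ ≈.sym assoc ⟩
    u ⨾ v ⨾ v′   ≈⟨ q ⟩⨾refl ⟩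
    w ⨾ v′       ∎
    where open HomReasoning

  invert-square : ∀ {A A′ B B′} {a : A ⇒ A′} {i : A′ ⇒ B′} {i′ : B′ ⇒ A′}
                    {j : A ⇒ B} {j′ : B ⇒ A} {b : B ⇒ B′} →
                  i ⨾ i′ ≈ id → j′ ⨾ j ≈ id → a ⨾ i ≈ j ⨾ b → j′ ⨾ a ≈ b ⨾ i′
  invert-square {a = a} {i} {i′} {j} {j′} {b} p q sq = begin
    j′ ⨾ a             ≈⟨ transposeʳ p ≈.refl ⟩
    j′ ⨾ a ⨾ i ⨾ i′    ≈⟨ assoc ⟩⨾refl ⟩
    j′ ⨾ (a ⨾ i) ⨾ i′  ≈⟨ (refl⟩⨾ sq) ⟩⨾refl ⟩
    j′ ⨾ (j ⨾ b) ⨾ i′  ≈⟨ ≈.sym assoc ⟩⨾refl ⟩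
    j′ ⨾ j ⨾ b ⨾ i′    ≈⟨ (q ⟩⨾refl) ⟩⨾refl ⟩
    id ⨾ b ⨾ i′        ≈⟨ identityˡ ⟩⨾refl ⟩
    b ⨾ i′             ∎
    where open HomReasoning

  cancel-split-epi : ∀ {A B C} {r : A ⇒ B} {e′ : B ⇒ A} {f g : A ⇒ C} →
                     r ⨾ e′ ≈ id → e′ ⨾ f ≈ e′ ⨾ g → f ≈ g
  cancel-split-epi {r = r} {e′} {f} {g} p q = begin
    f             ≈⟨ ≈.sym identityˡ ⟩
    id ⨾ f        ≈⟨ ≈.sym p ⟩⨾refl ⟩
    r ⨾ e′ ⨾ f    ≈⟨ assoc ⟩
    r ⨾ (e′ ⨾ f)  ≈⟨ refl⟩⨾ q ⟩
    r ⨾ (e′ ⨾ g)  ≈⟨ ≈.sym assoc ⟩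
    r ⨾ e′ ⨾ g    ≈⟨ p ⟩⨾refl ⟩
    id ⨾ g        ≈⟨ identityˡ ⟩
    g             ∎
    where open HomReasoning

module BifunctorReasoning {o ℓ e : Level} {𝒞 : Category o ℓ e} (M : SymmetricMonoidal 𝒞) where
  open Category 𝒞
  open SymmetricMonoidal M
  open CategoryReasoning 𝒞

  ·-square : ∀ {A B B′ C D E E′ F} {a : A ⇒ B} {c : B ⇒ C} {a′ : A ⇒ B′} {c′ : B′ ⇒ C}
               {b : D ⇒ E} {d : E ⇒ F} {b′ : D ⇒ E′} {d′ : E′ ⇒ F} →
             a ⨾ c ≈ a′ ⨾ c′ → b ⨾ d ≈ b′ ⨾ d′ →
             (a ·₁ b) ⨾ (c ·₁ d) ≈ (a′ ·₁ b′) ⨾ (c′ ·₁ d′)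
  ·-square p q = ≈.trans (≈.sym ·-homo) (≈.trans (·-resp-≈ p q) ·-homo)

  ·-inverse : ∀ {A A′ B B′} {f : A ⇒ B} {f′ : B ⇒ A} {g : A′ ⇒ B′} {g′ : B′ ⇒ A′} →
              f ⨾ f′ ≈ id → g ⨾ g′ ≈ id → (f ·₁ g) ⨾ (f′ ·₁ g′) ≈ id
  ·-inverse p q = ≈.trans (≈.sym ·-homo) (≈.trans (·-resp-≈ p q) ·-identity)


  ·id-merge : ∀ {A B C D} {f : A ⇒ B} {g : B ⇒ C} {h : A ⇒ C} →
              f ⨾ g ≈ h → (f ·₁ id {D}) ⨾ (g ·₁ id) ≈ h ·₁ id
  ·id-merge p = ≈.trans (≈.sym ·-homo) (·-resp-≈ p identityˡ)

  ·id-split : ∀ {A B C D} {f : A ⇒ B} {g : B ⇒ C} → (f ⨾ g) ·₁ id {D} ≈ (f ·₁ id) ⨾ (g ·₁ id)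
  ·id-split = ≈.sym (·id-merge ≈.refl)

module RigMonadLemmas {o ℓ e : Level} (S : Setting o ℓ e) where
  open Setting S using (𝒞; rig; coprod; monad; Mt; Mp)
  open Notation S
  open RigAxioms rig using (δʳ⁻¹; δʳ-isoˡ; δʳ-natural; λ•⁻¹; λ•-isoˡ; laplazaXVIII; laplazaXX)
  open FiniteCoproducts coprod using (¡-unique; []-unique; ∇-inj₁; ∇-inj₂)
  open SymmetricMonoidalMonad monad using (F-identity; F-homo; F-resp-≈; η-natural; μ-natural; m-natural)
  open CategoryReasoning 𝒞
  module ⊗ where
    open SymmetricMonoidal Mt public
    open BifunctorReasoning Mt public
  module ⊕ where
    open SymmetricMonoidal Mp public
    open BifunctorReasoning Mp public

  ¡-initial : ∀ {X} (f g : 𝟘 ⇒ X) → f ≈ g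
  ¡-initial f g = ≈.trans (≈.sym (¡-unique f)) (¡-unique g)

  id-commute : ∀ {A B} {f : A ⇒ B} → f ⨾ id ≈ id ⨾ f
  id-commute = ≈.trans identityʳ (≈.sym identityˡ)

  ιˡ-natural : ∀ {A A′ B B′} {f : A ⇒ A′} {g : B ⇒ B′} → ιˡ ⨾ (f ⊕₁ g) ≈ f ⨾ ιˡ
  ιˡ-natural {f = f} {g} = begin
    ρ⊕⁻¹ ⨾ (id ⊕₁ ¡) ⨾ (f ⊕₁ g)     ≈⟨ assoc ⟩
    ρ⊕⁻¹ ⨾ ((id ⊕₁ ¡) ⨾ (f ⊕₁ g))   ≈⟨ refl⟩⨾ ⊕.·-square (≈.sym id-commute) (¡-initial _ _) ⟩
    ρ⊕⁻¹ ⨾ ((f ⊕₁ id) ⨾ (id ⊕₁ ¡))  ≈⟨ ≈.sym assoc ⟩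
    ρ⊕⁻¹ ⨾ (f ⊕₁ id) ⨾ (id ⊕₁ ¡)    ≈⟨ invert-square ⊕.ρ-isoˡ ⊕.ρ-isoʳ ⊕.ρ-natural ⟩⨾refl ⟩
    f ⨾ ρ⊕⁻¹ ⨾ (id ⊕₁ ¡)            ≈⟨ assoc ⟩
    f ⨾ (ρ⊕⁻¹ ⨾ (id ⊕₁ ¡))          ∎
    where open HomReasoning

  ιʳ-natural : ∀ {A A′ B B′} {f : A ⇒ A′} {g : B ⇒ B′} → ιʳ ⨾ (f ⊕₁ g) ≈ g ⨾ ιʳ
  ιʳ-natural {f = f} {g} = begin
    λ⊕⁻¹ ⨾ (¡ ⊕₁ id) ⨾ (f ⊕₁ g)     ≈⟨ assoc ⟩
    λ⊕⁻¹ ⨾ ((¡ ⊕₁ id) ⨾ (f ⊕₁ g))   ≈⟨ refl⟩⨾ ⊕.·-square (¡-initial _ _) (≈.sym id-commute) ⟩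
    λ⊕⁻¹ ⨾ ((id ⊕₁ g) ⨾ (¡ ⊕₁ id))  ≈⟨ ≈.sym assoc ⟩
    λ⊕⁻¹ ⨾ (id ⊕₁ g) ⨾ (¡ ⊕₁ id)    ≈⟨ invert-square ⊕.λ-isoˡ ⊕.λ-isoʳ ⊕.λ-natural ⟩⨾refl ⟩
    g ⨾ λ⊕⁻¹ ⨾ (¡ ⊕₁ id)            ≈⟨ assoc ⟩
    g ⨾ (λ⊕⁻¹ ⨾ (¡ ⊕₁ id))          ∎
    where open HomReasoning

  ιˡ-⊕-∇ : ∀ {A B C} {f : A ⇒ C} {g : B ⇒ C} → ιˡ ⨾ ((f ⊕₁ g) ⨾ ∇) ≈ f
  ιˡ-⊕-∇ {f = f} {g} = begin
    ιˡ ⨾ ((f ⊕₁ g) ⨾ ∇)  ≈⟨ ≈.sym assoc ⟩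
    ιˡ ⨾ (f ⊕₁ g) ⨾ ∇    ≈⟨ ιˡ-natural ⟩⨾refl ⟩
    f ⨾ ιˡ ⨾ ∇           ≈⟨ assoc ⟩
    f ⨾ (ιˡ ⨾ ∇)         ≈⟨ refl⟩⨾ ∇-inj₁ ⟩
    f ⨾ id               ≈⟨ identityʳ ⟩
    f                    ∎
    where open HomReasoning

  ιʳ-⊕-∇ : ∀ {A B C} {f : A ⇒ C} {g : B ⇒ C} → ιʳ ⨾ ((f ⊕₁ g) ⨾ ∇) ≈ g
  ιʳ-⊕-∇ {f = f} {g} = begin
    ιʳ ⨾ ((f ⊕₁ g) ⨾ ∇)  ≈⟨ ≈.sym assoc ⟩
    ιʳ ⨾ (f ⊕₁ g) ⨾ ∇    ≈⟨ ιʳ-natural ⟩⨾refl ⟩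
    g ⨾ ιʳ ⨾ ∇           ≈⟨ assoc ⟩
    g ⨾ (ιʳ ⨾ ∇)         ≈⟨ refl⟩⨾ ∇-inj₂ ⟩
    g ⨾ id               ≈⟨ identityʳ ⟩
    g                    ∎
    where open HomReasoning

  ιˡ-k : ∀ {X Y} → ιˡ ⨾ k X Y ≈ T₁ ιˡ
  ιˡ-k = ιˡ-⊕-∇

  ιʳ-k : ∀ {X Y} → ιʳ ⨾ k X Y ≈ T₁ ιʳ
  ιʳ-k = ιʳ-⊕-∇

  injections-jointly-epic : ∀ {X Y W} {f g : X ⊕₀ Y ⇒ W} →
                            ιˡ ⨾ f ≈ ιˡ ⨾ g → ιʳ ⨾ f ≈ ιʳ ⨾ g → f ≈ g
  injections-jointly-epic {g = g} pˡ pʳ =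
    ≈.trans ([]-unique _ pˡ pʳ) (≈.sym ([]-unique g ≈.refl ≈.refl))

  -- Laplaza's axiom XX (resp. XVIII below) with every arrow inverted.
  ρ⊕⁻¹⊗id-δʳ : ∀ {X Z} → (ρ⊕⁻¹ ⊗₁ id {Z}) ⨾ δʳ {X} {𝟘} {Z} ≈ ρ⊕⁻¹ ⨾ (id ⊕₁ λ•⁻¹)
  ρ⊕⁻¹⊗id-δʳ = ≈.trans (transposeʳ (inverse-⨾ (⊕.·-inverse identityˡ λ•-isoˡ) ⊕.ρ-isoˡ) inverse) identityˡ
    where
    inverse : (ρ⊕⁻¹ ⊗₁ id) ⨾ δʳ ⨾ ((id ⊕₁ λ•) ⨾ ρ⊕) ≈ id
    inverse = ≈.trans assoc (≈.trans (refl⟩⨾ ≈.trans (≈.sym assoc) laplazaXX)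
                                     (⊗.·-inverse ⊕.ρ-isoʳ identityˡ))

  λ⊕⁻¹⊗id-δʳ : ∀ {Y Z} → (λ⊕⁻¹ ⊗₁ id {Z}) ⨾ δʳ {𝟘} {Y} {Z} ≈ λ⊕⁻¹ ⨾ (λ•⁻¹ ⊕₁ id)
  λ⊕⁻¹⊗id-δʳ = ≈.trans (transposeʳ (inverse-⨾ (⊕.·-inverse λ•-isoˡ identityˡ) ⊕.λ-isoˡ) inverse) identityˡ
    where
    inverse : (λ⊕⁻¹ ⊗₁ id) ⨾ δʳ ⨾ ((λ• ⊕₁ id) ⨾ λ⊕) ≈ id
    inverse = ≈.trans assoc (≈.trans (refl⟩⨾ ≈.trans (≈.sym assoc) laplazaXVIII)
                                     (⊗.·-inverse ⊕.λ-isoʳ identityˡ))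

  ιˡ⊗id-δʳ : ∀ {X Y Z} → (ιˡ {X} {Y} ⊗₁ id {Z}) ⨾ δʳ ≈ ιˡ
  ιˡ⊗id-δʳ = begin
    ((ρ⊕⁻¹ ⨾ (id ⊕₁ ¡)) ⊗₁ id) ⨾ δʳ                          ≈⟨ ⊗.·id-split ⟩⨾refl ⟩
    (ρ⊕⁻¹ ⊗₁ id) ⨾ ((id ⊕₁ ¡) ⊗₁ id) ⨾ δʳ                    ≈⟨ assoc ⟩
    (ρ⊕⁻¹ ⊗₁ id) ⨾ (((id ⊕₁ ¡) ⊗₁ id) ⨾ δʳ)                  ≈⟨ refl⟩⨾ δʳ-natural ⟩
    (ρ⊕⁻¹ ⊗₁ id) ⨾ (δʳ ⨾ ((id ⊗₁ id) ⊕₁ (¡ ⊗₁ id)))          ≈⟨ ≈.sym assoc ⟩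
    (ρ⊕⁻¹ ⊗₁ id) ⨾ δʳ ⨾ ((id ⊗₁ id) ⊕₁ (¡ ⊗₁ id))            ≈⟨ ρ⊕⁻¹⊗id-δʳ ⟩⨾refl ⟩
    ρ⊕⁻¹ ⨾ (id ⊕₁ λ•⁻¹) ⨾ ((id ⊗₁ id) ⊕₁ (¡ ⊗₁ id))          ≈⟨ assoc ⟩
    ρ⊕⁻¹ ⨾ ((id ⊕₁ λ•⁻¹) ⨾ ((id ⊗₁ id) ⊕₁ (¡ ⊗₁ id)))        ≈⟨ refl⟩⨾ ≈.sym ⊕.·-homo ⟩
    ρ⊕⁻¹ ⨾ ((id ⨾ (id ⊗₁ id)) ⊕₁ (λ•⁻¹ ⨾ (¡ ⊗₁ id)))         ≈⟨ refl⟩⨾ ⊕.·-resp-≈ (≈.trans identityˡ ⊗.·-identity) (¡-initial _ _) ⟩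
    ρ⊕⁻¹ ⨾ (id ⊕₁ ¡)                                         ∎
    where open HomReasoning

  ιʳ⊗id-δʳ : ∀ {X Y Z} → (ιʳ {X} {Y} ⊗₁ id {Z}) ⨾ δʳ ≈ ιʳ
  ιʳ⊗id-δʳ = begin
    ((λ⊕⁻¹ ⨾ (¡ ⊕₁ id)) ⊗₁ id) ⨾ δʳ                          ≈⟨ ⊗.·id-split ⟩⨾refl ⟩
    (λ⊕⁻¹ ⊗₁ id) ⨾ ((¡ ⊕₁ id) ⊗₁ id) ⨾ δʳ                    ≈⟨ assoc ⟩
    (λ⊕⁻¹ ⊗₁ id) ⨾ (((¡ ⊕₁ id) ⊗₁ id) ⨾ δʳ)                  ≈⟨ refl⟩⨾ δʳ-natural ⟩
    (λ⊕⁻¹ ⊗₁ id) ⨾ (δʳ ⨾ ((¡ ⊗₁ id) ⊕₁ (id ⊗₁ id)))          ≈⟨ ≈.sym assoc ⟩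
    (λ⊕⁻¹ ⊗₁ id) ⨾ δʳ ⨾ ((¡ ⊗₁ id) ⊕₁ (id ⊗₁ id))            ≈⟨ λ⊕⁻¹⊗id-δʳ ⟩⨾refl ⟩
    λ⊕⁻¹ ⨾ (λ•⁻¹ ⊕₁ id) ⨾ ((¡ ⊗₁ id) ⊕₁ (id ⊗₁ id))          ≈⟨ assoc ⟩
    λ⊕⁻¹ ⨾ ((λ•⁻¹ ⊕₁ id) ⨾ ((¡ ⊗₁ id) ⊕₁ (id ⊗₁ id)))        ≈⟨ refl⟩⨾ ≈.sym ⊕.·-homo ⟩
    λ⊕⁻¹ ⨾ ((λ•⁻¹ ⨾ (¡ ⊗₁ id)) ⊕₁ (id ⨾ (id ⊗₁ id)))         ≈⟨ refl⟩⨾ ⊕.·-resp-≈ (¡-initial _ _) (≈.trans identityˡ ⊗.·-identity) ⟩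
    λ⊕⁻¹ ⨾ (¡ ⊕₁ id)                                         ∎
    where open HomReasoning

  injections⊗id-jointly-epic : ∀ {X Y Z W} {f g : (X ⊕₀ Y) ⊗₀ Z ⇒ W} →
                               (ιˡ ⊗₁ id) ⨾ f ≈ (ιˡ ⊗₁ id) ⨾ g → (ιʳ ⊗₁ id) ⨾ f ≈ (ιʳ ⊗₁ id) ⨾ g →
                               f ≈ g
  injections⊗id-jointly-epic {X} {Y} {Z} {f = f} {g} pˡ pʳ =
    cancel-split-epi δʳ-isoˡ (injections-jointly-epic (through ιˡ⊗id-δʳ pˡ) (through ιʳ⊗id-δʳ pʳ))
    where
    through : ∀ {A} {i : A ⇒ X ⊕₀ Y} {j : A ⊗₀ Z ⇒ (X ⊗₀ Z) ⊕₀ (Y ⊗₀ Z)} → (i ⊗₁ id) ⨾ δʳ ≈ j →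
              (i ⊗₁ id) ⨾ f ≈ (i ⊗₁ id) ⨾ g → j ⨾ (δʳ⁻¹ ⨾ f) ≈ j ⨾ (δʳ⁻¹ ⨾ g)
    through {i = i} {j} q p = begin
      j ⨾ (δʳ⁻¹ ⨾ f)  ≈⟨ ≈.sym assoc ⟩
      j ⨾ δʳ⁻¹ ⨾ f    ≈⟨ ≈.sym (transposeʳ δʳ-isoˡ q) ⟩⨾refl ⟩
      (i ⊗₁ id) ⨾ f   ≈⟨ p ⟩
      (i ⊗₁ id) ⨾ g   ≈⟨ transposeʳ δʳ-isoˡ q ⟩⨾refl ⟩
      j ⨾ δʳ⁻¹ ⨾ g    ≈⟨ assoc ⟩
      j ⨾ (δʳ⁻¹ ⨾ g)  ∎
      where open HomReasoning

  lstr-natural : ∀ {X X′ Y Y′} {f : X ⇒ X′} {g : Y ⇒ Y′} →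
                 (f ⊗₁ T₁ g) ⨾ lstr X′ Y′ ≈ lstr X Y ⨾ T₁ (f ⊗₁ g)
  lstr-natural {f = f} {g} = begin
    (f ⊗₁ T₁ g) ⨾ ((η ⊗₁ id) ⨾ m)      ≈⟨ ≈.sym assoc ⟩
    (f ⊗₁ T₁ g) ⨾ (η ⊗₁ id) ⨾ m        ≈⟨ ⊗.·-square η-natural id-commute ⟩⨾refl ⟩
    (η ⊗₁ id) ⨾ (T₁ f ⊗₁ T₁ g) ⨾ m     ≈⟨ assoc ⟩
    (η ⊗₁ id) ⨾ ((T₁ f ⊗₁ T₁ g) ⨾ m)   ≈⟨ refl⟩⨾ m-natural ⟩
    (η ⊗₁ id) ⨾ (m ⨾ T₁ (f ⊗₁ g))      ≈⟨ ≈.sym assoc ⟩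
    (η ⊗₁ id) ⨾ m ⨾ T₁ (f ⊗₁ g)        ∎
    where open HomReasoning

  rstr-natural : ∀ {X X′ Y Y′} {f : X ⇒ X′} {g : Y ⇒ Y′} →
                 (T₁ f ⊗₁ g) ⨾ rstr X′ Y′ ≈ rstr X Y ⨾ T₁ (f ⊗₁ g)
  rstr-natural {f = f} {g} = begin
    (T₁ f ⊗₁ g) ⨾ ((id ⊗₁ η) ⨾ m)      ≈⟨ ≈.sym assoc ⟩
    (T₁ f ⊗₁ g) ⨾ (id ⊗₁ η) ⨾ m        ≈⟨ ⊗.·-square id-commute η-natural ⟩⨾refl ⟩
    (id ⊗₁ η) ⨾ (T₁ f ⊗₁ T₁ g) ⨾ m     ≈⟨ assoc ⟩
    (id ⊗₁ η) ⨾ ((T₁ f ⊗₁ T₁ g) ⨾ m)   ≈⟨ refl⟩⨾ m-natural ⟩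
    (id ⊗₁ η) ⨾ (m ⨾ T₁ (f ⊗₁ g))      ≈⟨ ≈.sym assoc ⟩
    (id ⊗₁ η) ⨾ m ⨾ T₁ (f ⊗₁ g)        ∎
    where open HomReasoning

  s-natural : ∀ {X X′ Y Y′} {f : X ⇒ X′} {g : Y ⇒ Y′} →
              (T₁ f ⊗₁ T₁ g) ⨾ s X′ Y′ ≈ s X Y ⨾ T₁ (f ⊗₁ g)
  s-natural {X} {X′} {Y} {Y′} {f} {g} = begin
    (T₁ f ⊗₁ T₁ g) ⨾ (rstr X′ (T₀ Y′) ⨾ T₁ (lstr X′ Y′) ⨾ μ)    ≈⟨ ≈.sym assoc ⟩
    (T₁ f ⊗₁ T₁ g) ⨾ (rstr X′ (T₀ Y′) ⨾ T₁ (lstr X′ Y′)) ⨾ μ    ≈⟨ ≈.sym assoc ⟩⨾refl ⟩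
    (T₁ f ⊗₁ T₁ g) ⨾ rstr X′ (T₀ Y′) ⨾ T₁ (lstr X′ Y′) ⨾ μ      ≈⟨ (rstr-natural ⟩⨾refl) ⟩⨾refl ⟩
    rstr X (T₀ Y) ⨾ T₁ (f ⊗₁ T₁ g) ⨾ T₁ (lstr X′ Y′) ⨾ μ        ≈⟨ assoc ⟩⨾refl ⟩
    rstr X (T₀ Y) ⨾ (T₁ (f ⊗₁ T₁ g) ⨾ T₁ (lstr X′ Y′)) ⨾ μ      ≈⟨ (refl⟩⨾ T-lstr-natural) ⟩⨾refl ⟩
    rstr X (T₀ Y) ⨾ (T₁ (lstr X Y) ⨾ T₁ (T₁ (f ⊗₁ g))) ⨾ μ      ≈⟨ ≈.sym assoc ⟩⨾refl ⟩
    rstr X (T₀ Y) ⨾ T₁ (lstr X Y) ⨾ T₁ (T₁ (f ⊗₁ g)) ⨾ μ        ≈⟨ assoc ⟩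
    rstr X (T₀ Y) ⨾ T₁ (lstr X Y) ⨾ (T₁ (T₁ (f ⊗₁ g)) ⨾ μ)      ≈⟨ refl⟩⨾ μ-natural ⟩
    rstr X (T₀ Y) ⨾ T₁ (lstr X Y) ⨾ (μ ⨾ T₁ (f ⊗₁ g))           ≈⟨ ≈.sym assoc ⟩
    rstr X (T₀ Y) ⨾ T₁ (lstr X Y) ⨾ μ ⨾ T₁ (f ⊗₁ g)             ∎
    where
    open HomReasoning
    T-lstr-natural : T₁ (f ⊗₁ T₁ g) ⨾ T₁ (lstr X′ Y′) ≈ T₁ (lstr X Y) ⨾ T₁ (T₁ (f ⊗₁ g))
    T-lstr-natural = ≈.trans (≈.sym F-homo) (≈.trans (F-resp-≈ lstr-natural) F-homo)

  s-naturalˡ : ∀ {X X′ Z} {f : X ⇒ X′} → (T₁ f ⊗₁ id) ⨾ s X′ Z ≈ s X Z ⨾ T₁ (f ⊗₁ id)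
  s-naturalˡ = ≈.trans (⊗.·-resp-≈ ≈.refl (≈.sym F-identity) ⟩⨾refl) s-natural

  distribute-then-strengthen : ∀ X Y Z → (T₀ X ⊕₀ T₀ Y) ⊗₀ T₀ Z ⇒ T₀ ((X ⊗₀ Z) ⊕₀ (Y ⊗₀ Z))
  distribute-then-strengthen X Y Z = δʳ ⨾ (s X Z ⊕₁ s Y Z) ⨾ k (X ⊗₀ Z) (Y ⊗₀ Z)

  strengthen-then-distribute : ∀ X Y Z → (T₀ X ⊕₀ T₀ Y) ⊗₀ T₀ Z ⇒ T₀ ((X ⊗₀ Z) ⊕₀ (Y ⊗₀ Z))
  strengthen-then-distribute X Y Z = (k X Y ⊗₁ id) ⨾ s (X ⊕₀ Y) Z ⨾ T₁ δʳ

  distribute-then-strengthen-ιˡ : ∀ X Y Z →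
    (ιˡ ⊗₁ id) ⨾ distribute-then-strengthen X Y Z ≈ s X Z ⨾ T₁ ιˡ
  distribute-then-strengthen-ιˡ X Y Z = begin
    (ιˡ ⊗₁ id) ⨾ (δʳ ⨾ (s X Z ⊕₁ s Y Z) ⨾ k _ _)     ≈⟨ ≈.trans (refl⟩⨾ assoc) (≈.sym assoc) ⟩
    (ιˡ ⊗₁ id) ⨾ δʳ ⨾ ((s X Z ⊕₁ s Y Z) ⨾ k _ _)     ≈⟨ ιˡ⊗id-δʳ ⟩⨾refl ⟩
    ιˡ ⨾ ((s X Z ⊕₁ s Y Z) ⨾ k _ _)                  ≈⟨ ≈.sym assoc ⟩
    ιˡ ⨾ (s X Z ⊕₁ s Y Z) ⨾ k _ _                    ≈⟨ ιˡ-natural ⟩⨾refl ⟩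
    s X Z ⨾ ιˡ ⨾ k _ _                               ≈⟨ assoc ⟩
    s X Z ⨾ (ιˡ ⨾ k _ _)                             ≈⟨ refl⟩⨾ ιˡ-k ⟩
    s X Z ⨾ T₁ ιˡ                                    ∎
    where open HomReasoning

  distribute-then-strengthen-ιʳ : ∀ X Y Z →
    (ιʳ ⊗₁ id) ⨾ distribute-then-strengthen X Y Z ≈ s Y Z ⨾ T₁ ιʳ
  distribute-then-strengthen-ιʳ X Y Z = begin
    (ιʳ ⊗₁ id) ⨾ (δʳ ⨾ (s X Z ⊕₁ s Y Z) ⨾ k _ _)     ≈⟨ ≈.trans (refl⟩⨾ assoc) (≈.sym assoc) ⟩
    (ιʳ ⊗₁ id) ⨾ δʳ ⨾ ((s X Z ⊕₁ s Y Z) ⨾ k _ _)     ≈⟨ ιʳ⊗id-δʳ ⟩⨾refl ⟩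
    ιʳ ⨾ ((s X Z ⊕₁ s Y Z) ⨾ k _ _)                  ≈⟨ ≈.sym assoc ⟩
    ιʳ ⨾ (s X Z ⊕₁ s Y Z) ⨾ k _ _                    ≈⟨ ιʳ-natural ⟩⨾refl ⟩
    s Y Z ⨾ ιʳ ⨾ k _ _                               ≈⟨ assoc ⟩
    s Y Z ⨾ (ιʳ ⨾ k _ _)                             ≈⟨ refl⟩⨾ ιʳ-k ⟩
    s Y Z ⨾ T₁ ιʳ                                    ∎
    where open HomReasoning

  strengthen-then-distribute-ιˡ : ∀ X Y Z →
    (ιˡ ⊗₁ id) ⨾ strengthen-then-distribute X Y Z ≈ s X Z ⨾ T₁ ιˡ
  strengthen-then-distribute-ιˡ X Y Z = begin
    (ιˡ ⊗₁ id) ⨾ ((k X Y ⊗₁ id) ⨾ s _ Z ⨾ T₁ δʳ)     ≈⟨ ≈.trans (≈.sym assoc) (≈.sym assoc ⟩⨾refl) ⟩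
    (ιˡ ⊗₁ id) ⨾ (k X Y ⊗₁ id) ⨾ s _ Z ⨾ T₁ δʳ       ≈⟨ (⊗.·id-merge ιˡ-k ⟩⨾refl) ⟩⨾refl ⟩
    (T₁ ιˡ ⊗₁ id) ⨾ s _ Z ⨾ T₁ δʳ                    ≈⟨ s-naturalˡ ⟩⨾refl ⟩
    s X Z ⨾ T₁ (ιˡ ⊗₁ id) ⨾ T₁ δʳ                    ≈⟨ assoc ⟩
    s X Z ⨾ (T₁ (ιˡ ⊗₁ id) ⨾ T₁ δʳ)                  ≈⟨ refl⟩⨾ ≈.trans (≈.sym F-homo) (F-resp-≈ ιˡ⊗id-δʳ) ⟩
    s X Z ⨾ T₁ ιˡ                                    ∎
    where open HomReasoning

  strengthen-then-distribute-ιʳ : ∀ X Y Z →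
    (ιʳ ⊗₁ id) ⨾ strengthen-then-distribute X Y Z ≈ s Y Z ⨾ T₁ ιʳ
  strengthen-then-distribute-ιʳ X Y Z = begin
    (ιʳ ⊗₁ id) ⨾ ((k X Y ⊗₁ id) ⨾ s _ Z ⨾ T₁ δʳ)     ≈⟨ ≈.trans (≈.sym assoc) (≈.sym assoc ⟩⨾refl) ⟩
    (ιʳ ⊗₁ id) ⨾ (k X Y ⊗₁ id) ⨾ s _ Z ⨾ T₁ δʳ       ≈⟨ (⊗.·id-merge ιʳ-k ⟩⨾refl) ⟩⨾refl ⟩
    (T₁ ιʳ ⊗₁ id) ⨾ s _ Z ⨾ T₁ δʳ                    ≈⟨ s-naturalˡ ⟩⨾refl ⟩
    s Y Z ⨾ T₁ (ιʳ ⊗₁ id) ⨾ T₁ δʳ                    ≈⟨ assoc ⟩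
    s Y Z ⨾ (T₁ (ιʳ ⊗₁ id) ⨾ T₁ δʳ)                  ≈⟨ refl⟩⨾ ≈.trans (≈.sym F-homo) (F-resp-≈ ιʳ⊗id-δʳ) ⟩
    s Y Z ⨾ T₁ ιʳ                                    ∎
    where open HomReasoning

lemma34 : ∀ {o ℓ e : Level} (S : Setting o ℓ e) → let open Notation S in
    ∀ X Y Z →
      δʳ {T₀ X} {T₀ Y} {T₀ Z} ⨾ (s X Z ⊕₁ s Y Z) ⨾ k (X ⊗₀ Z) (Y ⊗₀ Z)
        ≈ (k X Y ⊗₁ id) ⨾ s (X ⊕₀ Y) Z ⨾ T₁ (δʳ {X} {Y} {Z})
lemma34 S X Y Z = injections⊗id-jointly-epic
    (≈.trans (distribute-then-strengthen-ιˡ X Y Z) (≈.sym (strengthen-then-distribute-ιˡ X Y Z)))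
    (≈.trans (distribute-then-strengthen-ιʳ X Y Z) (≈.sym (strengthen-then-distribute-ιʳ X Y Z)))
  where
  open RigMonadLemmas S
  open CategoryReasoning (Setting.𝒞 S) using (module ≈)
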